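{- Let $T$ be a tournament tree of a list of $n$ pairwise distinct numbers, let $x_1<x_2<\dots<x_n$ be these numbers in increasing order, and let $u_j$ be the leaf of $T$ with value $x_j$. Then for every $1\le i<n$, $\sup(u_{i+1})\in \mathrm{Can}(\{u_1,\dots,u_i\})$.
   Context: A tournament tree of a list $a_1,\dots,a_n$ of pairwise distinct numbers is a full binary tree (every internal node has two children) that is balanced (at every node the heights of the two child subtrees differ by at most 1), has exactly $n$ leaves with values $a_1,\dots,a_n$ from left to right, and every internal node has value equal to the minimum of its children's values. The principal path $\mathrm{Path}(u)$ of a node $u$ is the set of nodes $v$ with $\mathrm{val}(v)=\mathrm{val}(u)$ (it is a path going upward from a leaf). For an internal node $u$, its subordinate $\mathrm{sub}(u)$ is the child of $u$ not in $\mathrm{Path}(u)$. The superordinate $\sup(v)$ of a node $v$ is the node of $T$ whose subordinate belongs to $\mathrm{Path}(v)$ (it exists whenever $\mathrm{Path}(v)$ does not contain the root). For a set $U$ of nodes, $\sup(U)=\{\sup(v): v\in U\}$ (over those $v$ having a superordinate). A node $v$ is a $U$-candidate if there is $u\in U$ with $v\in\mathrm{Path}(u)$ such that for every internal node $w\in\mathrm{Path}(u)$: $\mathrm{val}(\mathrm{sub}(w))<\mathrm{val}(\mathrm{sub}(v))$ if and only if $w\in\sup(U)$. $\mathrm{Can}(U)$ denotes the set of $U$-candidates. -}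

module Defs where

open import Data.Nat using (ℕ; zero; suc; _≤_; _<_; _⊓_; _⊔_; _≟_)
open import Data.List using (List; []; _∷_; _++_; take)
open import Data.List.Membership.Propositional using (_∈_)
open import Data.List.Relation.Unary.Unique.Propositional using (Unique)
open import Data.Product using (Σ; ∃; ∃-syntax; _×_; _,_)
open import Data.Unit using (⊤)
open import Data.Empty using (⊥)
open import Relation.Binary.PropositionalEquality using (_≡_)
open import Relation.Nullary using (yes; no)

-- Binary trees whose leaves carry natural numbers (a "number" only matters
-- through comparisons, so ℕ is used as the value domain).
data Tree : Set where
  leaf : ℕ → Tree
  node : Tree → Tree → Tree

-- Value of a node: leaves carry their value, internal nodes the minimum of
-- the values of their children (this is the tournament-tree condition).
val : Tree → ℕ
val (leaf x)   = x
val (node l r) = val l ⊓ val r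

height : Tree → ℕ
height (leaf _)   = zero
height (node l r) = suc (height l ⊔ height r)

Balanced : Tree → Set
Balanced (leaf _)   = ⊤
Balanced (node l r) =
  Balanced l × Balanced r × height l ≤ suc (height r) × height r ≤ suc (height l)

leaves : Tree → List ℕ
leaves (leaf x)   = x ∷ []
leaves (node l r) = leaves l ++ leaves r

TournamentTree : List ℕ → Tree → Set
TournamentTree a T = Unique a × Balanced T × leaves T ≡ a

-- Nodes of a tree T: positions, given as paths from the root.
data Pos : Tree → Set where
  here  : ∀ {t} → Pos t
  left  : ∀ {l r} → Pos l → Pos (node l r)
  right : ∀ {l r} → Pos r → Pos (node l r)

at : ∀ {T} → Pos T → Tree
at {T} here  = T
at (left p)  = at p
at (right p) = at p

vl : ∀ {T} → Pos T → ℕ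
vl p = val (at p)

IsLeaf : Tree → Set
IsLeaf (leaf _)   = ⊤
IsLeaf (node _ _) = ⊥

IsInternal : Tree → Set
IsInternal (leaf _)   = ⊥
IsInternal (node _ _) = ⊤

-- subordinate of an internal node: the child not on its principal path,
-- i.e. the child whose value differs from the node's value.
-- (On leaves the result is meaningless and is only used under IsInternal.)
subT : Tree → Tree
subT (leaf x) = leaf x
subT (node l r) with val l ≟ (val l ⊓ val r)
... | yes _ = r
... | no  _ = l

InPath : ∀ {T} → Pos T → Pos T → Set
InPath u v = vl v ≡ vl u

-- w = sup(v): w is internal and sub(w) ∈ Path(v)
IsSup : ∀ {T} → Pos T → Pos T → Set
IsSup v w = IsInternal (at w) × val (subT (at w)) ≡ vl v

InSup : ∀ {T} → (Pos T → Set) → Pos T → Set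
InSup U w = ∃[ v ] (U v × IsSup v w)

-- v ∈ Can(U)  (v is required to be internal so that sub(v) exists)
Candidate : ∀ {T} → (Pos T → Set) → Pos T → Set
Candidate {T} U v =
  IsInternal (at v) ×
  ∃[ u ] (U u × InPath u v ×
    ((w : Pos T) → InPath u w → IsInternal (at w) →
      ((val (subT (at w)) < val (subT (at v)) → InSup U w) ×
       (InSup U w → val (subT (at w)) < val (subT (at v))))))

FirstLeaves : ∀ {T} → List ℕ → ℕ → Pos T → Set
FirstLeaves xs i u = IsLeaf (at u) × vl u ∈ take i xs

-- Let x = x_{i+1} and U = {u_1,…,u_i}.  Since the values are sorted, a leaf
-- value y lies in U exactly when y < x.  Walking down from the root to u_{i+1}
-- we find the highest node whose value is x; its parent w has subordinate
-- value x and value vl w < x (root value x_1 < x because i ≥ 1), so w is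
-- sup(u_{i+1}).  As vl w < x, the leaf u' with value vl w lies in U, and w is
-- on Path(u').  Every subordinate value is a leaf value, so for any internal
-- node w', val(sub w') < val(sub w) = x holds iff sub(w') carries the value of
-- some leaf of U, i.e. iff w' ∈ sup(U); this is the candidate condition.
module Submission where

open import Defs
open import Data.Nat using (ℕ; _≤_; _<_; suc; _⊓_; _≟_)
open import Data.Nat.Properties
  using (≤∧≢⇒<; m⊓n≤m; m⊓n≤n; ⊓-sel; <-trans; ≤-<-trans; <-irrefl; ≤-trans; ≤-refl)
open import Data.List using (List; _∷_; drop; take)
open import Data.List.Relation.Unary.Linked using (Linked)
open import Data.List.Relation.Unary.Linked.Properties using (Linked⇒AllPairs)
open import Data.List.Relation.Unary.AllPairs using (AllPairs; _∷_)
open import Data.List.Relation.Unary.All as All using (All; lookup)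
open import Data.List.Relation.Unary.All.Properties using (drop⁺)
open import Data.List.Relation.Unary.Any using (here; there)
open import Data.List.Membership.Propositional using (_∈_)
open import Data.List.Membership.Propositional.Properties using (∈-++⁺ˡ; ∈-++⁺ʳ; ∈-++⁻)
open import Data.List.Relation.Binary.Permutation.Propositional
  using (_↭_; ↭-sym; ↭-trans; ↭-reflexive)
open import Data.List.Relation.Binary.Permutation.Propositional.Properties using (∈-resp-↭)
open import Data.Product using (∃-syntax; _×_; _,_; map)
open import Data.Sum using (inj₁; inj₂)
open import Data.Unit using (tt)
open import Data.Empty using (⊥-elim)
open import Function using (id)
open import Relation.Nullary using (yes; no; ¬_)
open import Relation.Binary.PropositionalEquality using (_≡_; refl; sym; trans; subst; cong)

prefix-before-next : ∀ {R : ℕ → ℕ → Set} {y x rest} i (xs : List ℕ) →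
  AllPairs R xs → y ∈ take i xs → drop i xs ≡ x ∷ rest → R y x
prefix-before-next (suc k) (z ∷ zs) (z< ∷ _) (here refl) split =
  All.head (subst (All _) split (drop⁺ k z<))
prefix-before-next (suc k) (z ∷ zs) (_ ∷ sorted) (there y∈) split =
  prefix-before-next k zs sorted y∈ split

below-next-in-prefix : ∀ {y x rest} i (xs : List ℕ) →
  AllPairs _<_ xs → y ∈ xs → y < x → drop i xs ≡ x ∷ rest → y ∈ take i xs
below-next-in-prefix 0 (z ∷ zs) _ (here refl) y<x refl = ⊥-elim (<-irrefl refl y<x)
below-next-in-prefix 0 (z ∷ zs) (z< ∷ _) (there y∈) y<x refl =
  ⊥-elim (<-irrefl refl (<-trans y<x (lookup z< y∈)))
below-next-in-prefix (suc k) (z ∷ zs) _ (here refl) _ _ = here refl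
below-next-in-prefix (suc k) (z ∷ zs) (_ ∷ sorted) (there y∈) y<x split =
  there (below-next-in-prefix k zs sorted y∈ y<x split)

entry-before-next : ∀ {R : ℕ → ℕ → Set} {x rest} i (xs : List ℕ) →
  AllPairs R xs → 1 ≤ i → drop i xs ≡ x ∷ rest → ∃[ y ] (y ∈ xs × R y x)
entry-before-next (suc k) (z ∷ zs) sorted _ split =
  z , here refl , prefix-before-next (suc k) (z ∷ zs) sorted (here refl) split

val-attained : ∀ t → val t ∈ leaves t
val-attained (leaf x) = here refl
val-attained (node l r) with ⊓-sel (val l) (val r)
... | inj₁ e = subst (_∈ leaves (node l r)) (sym e) (∈-++⁺ˡ (val-attained l))
... | inj₂ e = subst (_∈ leaves (node l r)) (sym e) (∈-++⁺ʳ (leaves l) (val-attained r))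

val-≤-leaves : ∀ {y} t → y ∈ leaves t → val t ≤ y
val-≤-leaves (leaf x) (here refl) = ≤-refl
val-≤-leaves (node l r) y∈ with ∈-++⁻ (leaves l) y∈
... | inj₁ y∈l = ≤-trans (m⊓n≤m (val l) (val r)) (val-≤-leaves l y∈l)
... | inj₂ y∈r = ≤-trans (m⊓n≤n (val l) (val r)) (val-≤-leaves r y∈r)

leaves-at : ∀ {T y} (p : Pos T) → y ∈ leaves (at p) → y ∈ leaves T
leaves-at here y∈ = y∈
leaves-at {node l r} (left p) y∈ = ∈-++⁺ˡ (leaves-at p y∈)
leaves-at {node l r} (right p) y∈ = ∈-++⁺ʳ (leaves l) (leaves-at p y∈)

leaves-subT : ∀ {y} t → y ∈ leaves (subT t) → y ∈ leaves t
leaves-subT (leaf x) y∈ = y∈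
leaves-subT (node l r) y∈ with val l ≟ (val l ⊓ val r)
... | yes _ = ∈-++⁺ʳ (leaves l) y∈
... | no _ = ∈-++⁺ˡ y∈

leaf-position : ∀ {y} t → y ∈ leaves t → ∃[ p ] (IsLeaf (at {t} p) × vl p ≡ y)
leaf-position (leaf x) (here refl) = here , tt , refl
leaf-position (node l r) y∈ with ∈-++⁻ (leaves l) y∈
... | inj₁ y∈l = map left id (leaf-position l y∈l)
... | inj₂ y∈r = map right id (leaf-position r y∈r)

node-value-leaf : ∀ {T} (w : Pos T) → vl w ∈ leaves T
node-value-leaf w = leaves-at w (val-attained (at w))

sub-value-leaf : ∀ {T} (w : Pos T) → val (subT (at w)) ∈ leaves T
sub-value-leaf w = leaves-at w (leaves-subT (at w) (val-attained (subT (at w))))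

subT-left : ∀ l r → ¬ val l ≡ val l ⊓ val r → subT (node l r) ≡ l
subT-left l r l≢ with val l ≟ (val l ⊓ val r)
... | yes l≡ = ⊥-elim (l≢ l≡)
... | no _ = refl

subT-right : ∀ l r → ¬ val r ≡ val l ⊓ val r → subT (node l r) ≡ r
subT-right l r r≢ with val l ≟ (val l ⊓ val r) | ⊓-sel (val l) (val r)
... | yes _  | _      = refl
... | no l≢  | inj₁ e = ⊥-elim (l≢ (sym e))
... | no _   | inj₂ e = ⊥-elim (r≢ (sym e))

superordinate : ∀ {x} t (p : Pos t) → vl p ≡ x → ¬ val t ≡ x →
  ∃[ w ] (IsInternal (at {t} w) × val (subT (at w)) ≡ x × vl w < x)
superordinate t here p≡x t≢x = ⊥-elim (t≢x p≡x)
superordinate {x} (node l r) (left p) p≡x t≢x with val l ≟ x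
... | no l≢x = map left id (superordinate l p p≡x l≢x)
... | yes l≡x =
  here , tt , trans (cong val (subT-left l r (λ e → t≢x (trans (sym e) l≡x)))) l≡x ,
  ≤∧≢⇒< (subst (val l ⊓ val r ≤_) l≡x (m⊓n≤m (val l) (val r))) t≢x
superordinate {x} (node l r) (right p) p≡x t≢x with val r ≟ x
... | no r≢x = map right id (superordinate r p p≡x r≢x)
... | yes r≡x =
  here , tt , trans (cong val (subT-right l r (λ e → t≢x (trans (sym e) r≡x)))) r≡x ,
  ≤∧≢⇒< (subst (val l ⊓ val r ≤_) r≡x (m⊓n≤n (val l) (val r))) t≢x

module FirstLeavesBelow (T : Tree) {xs : List ℕ} (sorted : AllPairs _<_ xs)
  (perm : leaves T ↭ xs) (i : ℕ) {x : ℕ} {rest : List ℕ}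
  (split : drop i xs ≡ x ∷ rest) where

  first-below : (v : Pos T) → FirstLeaves xs i v → vl v < x
  first-below v (_ , v∈) = prefix-before-next i xs sorted v∈ split

  below-first : ∀ {y} → y ∈ leaves T → y < x → ∃[ v ] (FirstLeaves xs i v × vl v ≡ y)
  below-first y∈ y<x with leaf-position T y∈
  ... | v , isLeaf , v≡y =
    v , (isLeaf , subst (_∈ take i xs) (sym v≡y)
                    (below-next-in-prefix i xs sorted (∈-resp-↭ perm y∈) y<x split)) , v≡y

  root-below : 1 ≤ i → val T < x
  root-below 1≤i with entry-before-next i xs sorted 1≤i split
  ... | y , y∈ , y<x = ≤-<-trans (val-≤-leaves T (∈-resp-↭ (↭-sym perm) y∈)) y<x

  sup-iff-below : ∀ {s} → s ≡ x → (w : Pos T) → IsInternal (at w) →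
    (val (subT (at w)) < s → InSup (FirstLeaves xs i) w) ×
    (InSup (FirstLeaves xs i) w → val (subT (at w)) < s)
  sup-iff-below refl w w-int = into-sup , from-sup
    where
    into-sup : val (subT (at w)) < x → InSup (FirstLeaves xs i) w
    into-sup sub<x with below-first (sub-value-leaf w) sub<x
    ... | v , Uv , v≡sub = v , Uv , w-int , sym v≡sub
    from-sup : InSup (FirstLeaves xs i) w → val (subT (at w)) < x
    from-sup (v , Uv , _ , sub≡v) = subst (_< x) (sym sub≡v) (first-below v Uv)

-- w = sup(u_{i+1}) is a U_i-candidate, witnessed by the leaf u' ∈ U_i that
-- carries the value of w.
lemma4 : (a : List ℕ) (T : Tree) → TournamentTree a T →
    (xs : List ℕ) → xs ↭ a → Linked _<_ xs →
    (i : ℕ) → 1 ≤ i → (x : ℕ) (rest : List ℕ) → drop i xs ≡ x ∷ rest →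
    (u : Pos T) → IsLeaf (at u) → vl u ≡ x →
    ∃[ w ] (IsSup u w × Candidate (FirstLeaves xs i) w)
lemma4 a T (_ , _ , leaves≡a) xs xs↭a increasing i 1≤i x rest split u _ u≡x =
  let w , w-int , sub≡x , w<x = superordinate T u u≡x (λ T≡x → <-irrefl T≡x (root-below 1≤i))
      u' , Uu' , u'≡w = below-first (node-value-leaf w) w<x
  in w , (w-int , trans sub≡x (sym u≡x)) ,
     w-int , u' , Uu' , sym u'≡w , λ w' _ → sup-iff-below sub≡x w'
  where
  open FirstLeavesBelow T (Linked⇒AllPairs <-trans increasing)
                        (↭-trans (↭-reflexive leaves≡a) (↭-sym xs↭a)) i split
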